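{- Define maps on pairs of integers $(d,m)$ with $d\neq 0$ by $L(d,m) = (d, m+d)$ and $R(d,m) = \left(\frac{(m+d)^2+1}{d},\ m + \frac{m^2+1}{d}\right)$. Consider the infinite rooted binary tree whose root is labeled by the pair $(1,0)$ and in which every node labeled $(d,m)$ has a left child labeled $L(d,m)$ and a right child labeled $R(d,m)$. If a pair $(d,m)$ appears as the label of some node of this tree, then $d$ and $m$ are integers with $d\geq 1$, $m\geq 0$, and $d$ divides $m^2+1$. -}

module Defs where

open import Data.Rational using (ℚ; _+_; _*_; _÷_; NonZero; 1ℚ; 0ℚ)
open import Data.Product using (_×_; _,_)

-- Labels are pairs (d , m) of rationals; a priori the right map involves
-- division, so we work in ℚ and the theorem asserts integrality.

L : ℚ × ℚ → ℚ × ℚ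
L (d , m) = (d , m + d)

R : (d m : ℚ) → .{{_ : NonZero d}} → ℚ × ℚ
R d m = (((m + d) * (m + d) + 1ℚ) ÷ d , m + ((m * m + 1ℚ) ÷ d))

data InTree : ℚ × ℚ → Set where
  root  : InTree (1ℚ , 0ℚ)
  left  : ∀ {d m} → InTree (d , m) → InTree (L (d , m))
  right : ∀ {d m} → InTree (d , m) → .{{nz : NonZero d}} → InTree (R d m)

-- Every label is (x , y) for naturals x ≥ 1 and y with y² + 1 = x k for a natural k.
-- This invariant is preserved: L sends (x , y ; k) to (x , y + x ; x + 2y + k) and,
-- since (y + x)² + 1 = x (x + 2y + k), R sends it to (x + 2y + k , y + k ; k),
-- the last by the same identity with the roles of x and k exchanged.
module Submission where

open import Defs
open import Data.Integer using (ℤ; _≤_; _*_; _+_; +_)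
open import Data.Integer.Divisibility using (_∣_)
open import Data.Rational using (ℚ; _/_)
open import Data.Product using (_×_; _,_; ∃₂; proj₁; proj₂)
open import Relation.Binary.PropositionalEquality using (_≡_; refl; sym; trans; cong; cong₂; subst; module ≡-Reasoning)

open import Data.List.Base using (_∷_; [])
open import Data.Nat.Base as ℕ using (ℕ; z≤n)
import Data.Nat.Divisibility as ℕ
import Data.Nat.Properties as ℕ
open import Data.Nat.Tactic.RingSolver using (solve)
import Data.Integer as ℤ
import Data.Integer.Properties as ℤ
import Data.Rational as ℚ
import Data.Rational.Properties as ℚ
import Data.Rational.Unnormalised as ℚᵘ
import Data.Rational.Unnormalised.Properties as ℚᵘ

toℚᵘ-/1 : ∀ i → ℚ.toℚᵘ (i / 1) ℚᵘ.≃ i ℚᵘ./ 1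
toℚᵘ-/1 i = ℚ.toℚᵘ-fromℚᵘ (i ℚᵘ./ 1)

/1-homo-+ : ∀ i j → (i + j) / 1 ≡ i / 1 ℚ.+ j / 1
/1-homo-+ i j = ℚ.toℚᵘ-injective (begin
  ℚ.toℚᵘ ((i + j) / 1)                  ≈⟨ toℚᵘ-/1 (i + j) ⟩
  (i + j) ℚᵘ./ 1                        ≈⟨ ℚᵘ.*≡* (cong (_* + 1) (sym (cong₂ _+_ (ℤ.*-identityʳ i) (ℤ.*-identityʳ j)))) ⟩
  i ℚᵘ./ 1 ℚᵘ.+ j ℚᵘ./ 1                ≈⟨ ℚᵘ.+-cong (toℚᵘ-/1 i) (toℚᵘ-/1 j) ⟨
  ℚ.toℚᵘ (i / 1) ℚᵘ.+ ℚ.toℚᵘ (j / 1)    ≈⟨ ℚ.toℚᵘ-homo-+ (i / 1) (j / 1) ⟨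
  ℚ.toℚᵘ (i / 1 ℚ.+ j / 1)              ∎)
  where open ℚᵘ.≃-Reasoning

/1-homo-* : ∀ i j → (i * j) / 1 ≡ (i / 1) ℚ.* (j / 1)
/1-homo-* i j = ℚ.toℚᵘ-injective (begin
  ℚ.toℚᵘ ((i * j) / 1)                  ≈⟨ toℚᵘ-/1 (i * j) ⟩
  (i * j) ℚᵘ./ 1                        ≈⟨ ℚᵘ.*≡* refl ⟩
  (i ℚᵘ./ 1) ℚᵘ.* (j ℚᵘ./ 1)            ≈⟨ ℚᵘ.*-cong (toℚᵘ-/1 i) (toℚᵘ-/1 j) ⟨
  ℚ.toℚᵘ (i / 1) ℚᵘ.* ℚ.toℚᵘ (j / 1)    ≈⟨ ℚ.toℚᵘ-homo-* (i / 1) (j / 1) ⟨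
  ℚ.toℚᵘ ((i / 1) ℚ.* (j / 1))          ∎)
  where open ℚᵘ.≃-Reasoning

p*q÷p≡q : ∀ p q .{{_ : ℚ.NonZero p}} → (p ℚ.* q) ℚ.÷ p ≡ q
p*q÷p≡q p q = begin
  (p ℚ.* q) ℚ.* ℚ.1/ p   ≡⟨ cong (ℚ._* ℚ.1/ p) (ℚ.*-comm p q) ⟩
  (q ℚ.* p) ℚ.* ℚ.1/ p   ≡⟨ ℚ.*-assoc q p (ℚ.1/ p) ⟩
  q ℚ.* (p ℚ.* ℚ.1/ p)   ≡⟨ cong (q ℚ.*_) (ℚ.*-inverseʳ p) ⟩
  q ℚ.* ℚ.1ℚ             ≡⟨ ℚ.*-identityʳ q ⟩
  q                      ∎
  where open ≡-Reasoning

ι : ℕ → ℚ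
ι n = + n / 1

ι-homo-+ : ∀ m n → ι (m ℕ.+ n) ≡ ι m ℚ.+ ι n
ι-homo-+ m n = /1-homo-+ (+ m) (+ n)

ι-homo-* : ∀ m n → ι (m ℕ.* n) ≡ ι m ℚ.* ι n
ι-homo-* m n = trans (cong (_/ 1) (ℤ.pos-* m n)) (/1-homo-* (+ m) (+ n))

ι[n*n+1] : ∀ n → ι (n ℕ.* n ℕ.+ 1) ≡ ι n ℚ.* ι n ℚ.+ ℚ.1ℚ
ι[n*n+1] n = trans (ι-homo-+ (n ℕ.* n) 1) (cong (ℚ._+ ℚ.1ℚ) (ι-homo-* n n))

ι-÷ : ∀ {a} x k .{{_ : ℚ.NonZero (ι x)}} → a ≡ x ℕ.* k → ι a ℚ.÷ ι x ≡ ι k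
ι-÷ x k refl = trans (cong (ℚ._÷ ι x) (ι-homo-* x k)) (p*q÷p≡q (ι x) (ι k))

y²+1≡xk⇒[y+x]²+1≡x[x+2y+k] : ∀ x y k → y ℕ.* y ℕ.+ 1 ≡ x ℕ.* k →
  (y ℕ.+ x) ℕ.* (y ℕ.+ x) ℕ.+ 1 ≡ x ℕ.* (x ℕ.+ 2 ℕ.* y ℕ.+ k)
y²+1≡xk⇒[y+x]²+1≡x[x+2y+k] x y k h = begin
  (y ℕ.+ x) ℕ.* (y ℕ.+ x) ℕ.+ 1               ≡⟨ solve (x ∷ y ∷ []) ⟩
  (y ℕ.* y ℕ.+ 1) ℕ.+ x ℕ.* (x ℕ.+ 2 ℕ.* y)   ≡⟨ cong (ℕ._+ x ℕ.* (x ℕ.+ 2 ℕ.* y)) h ⟩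
  x ℕ.* k ℕ.+ x ℕ.* (x ℕ.+ 2 ℕ.* y)           ≡⟨ solve (x ∷ y ∷ k ∷ []) ⟩
  x ℕ.* (x ℕ.+ 2 ℕ.* y ℕ.+ k)                 ∎
  where open ≡-Reasoning

y²+1≡xk⇒[y+k]²+1≡[x+2y+k]k : ∀ x y k → y ℕ.* y ℕ.+ 1 ≡ x ℕ.* k →
  (y ℕ.+ k) ℕ.* (y ℕ.+ k) ℕ.+ 1 ≡ (x ℕ.+ 2 ℕ.* y ℕ.+ k) ℕ.* k
y²+1≡xk⇒[y+k]²+1≡[x+2y+k]k x y k h = begin
  (y ℕ.+ k) ℕ.* (y ℕ.+ k) ℕ.+ 1   ≡⟨ y²+1≡xk⇒[y+x]²+1≡x[x+2y+k] k y x (trans h (ℕ.*-comm x k)) ⟩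
  k ℕ.* (k ℕ.+ 2 ℕ.* y ℕ.+ x)     ≡⟨ solve (x ∷ y ∷ k ∷ []) ⟩
  (x ℕ.+ 2 ℕ.* y ℕ.+ k) ℕ.* k     ∎
  where open ≡-Reasoning

R-ι : ∀ x y k .{{_ : ℚ.NonZero (ι x)}} → y ℕ.* y ℕ.+ 1 ≡ x ℕ.* k →
      R (ι x) (ι y) ≡ (ι (x ℕ.+ 2 ℕ.* y ℕ.+ k) , ι (y ℕ.+ k))
R-ι x y k h = cong₂ _,_ d≡ m≡
  where
  open ≡-Reasoning
  d≡ : ((ι y ℚ.+ ι x) ℚ.* (ι y ℚ.+ ι x) ℚ.+ ℚ.1ℚ) ℚ.÷ ι x ≡ ι (x ℕ.+ 2 ℕ.* y ℕ.+ k)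
  d≡ = begin
    ((ι y ℚ.+ ι x) ℚ.* (ι y ℚ.+ ι x) ℚ.+ ℚ.1ℚ) ℚ.÷ ι x
      ≡⟨ cong (λ z → (z ℚ.* z ℚ.+ ℚ.1ℚ) ℚ.÷ ι x) (ι-homo-+ y x) ⟨
    (ι (y ℕ.+ x) ℚ.* ι (y ℕ.+ x) ℚ.+ ℚ.1ℚ) ℚ.÷ ι x
      ≡⟨ cong (ℚ._÷ ι x) (ι[n*n+1] (y ℕ.+ x)) ⟨
    ι ((y ℕ.+ x) ℕ.* (y ℕ.+ x) ℕ.+ 1) ℚ.÷ ι x
      ≡⟨ ι-÷ x _ (y²+1≡xk⇒[y+x]²+1≡x[x+2y+k] x y k h) ⟩
    ι (x ℕ.+ 2 ℕ.* y ℕ.+ k) ∎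
  m≡ : ι y ℚ.+ ((ι y ℚ.* ι y ℚ.+ ℚ.1ℚ) ℚ.÷ ι x) ≡ ι (y ℕ.+ k)
  m≡ = begin
    ι y ℚ.+ ((ι y ℚ.* ι y ℚ.+ ℚ.1ℚ) ℚ.÷ ι x)   ≡⟨ cong (λ z → ι y ℚ.+ z ℚ.÷ ι x) (ι[n*n+1] y) ⟨
    ι y ℚ.+ (ι (y ℕ.* y ℕ.+ 1) ℚ.÷ ι x)         ≡⟨ cong (ι y ℚ.+_) (ι-÷ x k h) ⟩
    ι y ℚ.+ ι k                                 ≡⟨ ι-homo-+ y k ⟨
    ι (y ℕ.+ k)                                 ∎

record Node (d m : ℚ) : Set where
  constructor node
  field
    x y k     : ℕ
    d≡x       : d ≡ ι x
    m≡y       : m ≡ ι y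
    1≤x       : 1 ℕ.≤ x
    y²+1≡x*k  : y ℕ.* y ℕ.+ 1 ≡ x ℕ.* k

inTree⇒node : ∀ {d m} → InTree (d , m) → Node d m
inTree⇒node root = node 1 0 1 refl refl ℕ.≤-refl refl
inTree⇒node (left t) with inTree⇒node t
... | node x y k refl refl 1≤x h =
  node x (y ℕ.+ x) (x ℕ.+ 2 ℕ.* y ℕ.+ k) refl (sym (ι-homo-+ y x)) 1≤x
       (y²+1≡xk⇒[y+x]²+1≡x[x+2y+k] x y k h)
inTree⇒node (right t) with inTree⇒node t
... | node x y k refl refl 1≤x h =
  node (x ℕ.+ 2 ℕ.* y ℕ.+ k) (y ℕ.+ k) k
       (cong proj₁ (R-ι x y k h)) (cong proj₂ (R-ι x y k h))
       (ℕ.m≤n⇒m≤n+o k (ℕ.m≤n⇒m≤n+o (2 ℕ.* y) 1≤x))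
       (y²+1≡xk⇒[y+k]²+1≡[x+2y+k]k x y k h)

lemma5 : ∀ (d m : ℚ) → InTree (d , m) →
    ∃₂ λ (a b : ℤ) → d ≡ a / 1 × m ≡ b / 1 × + 1 ≤ a × + 0 ≤ b × a ∣ (b * b + + 1)
lemma5 d m t with inTree⇒node t
... | node x y k d≡x m≡y 1≤x h =
  + x , + y , d≡x , m≡y , ℤ.+≤+ 1≤x , ℤ.+≤+ z≤n , x∣y²+1
  where
  x∣y²+1 : + x ∣ + y * + y + + 1
  x∣y²+1 = subst (λ n → x ℕ.∣ ℤ.∣ n ℤ.+ + 1 ∣) (ℤ.pos-* y y)
             (subst (x ℕ.∣_) (sym h) (ℕ.m∣m*n k))
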